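{- Let $n,m$ be natural numbers with $m\le n$, $P$ a predicate on families, and $Q$ a predicate on pairs (family, set) that incrementally checks $P$ and is preserved by injective functions. Let $[l_0,\ldots,l_m]$ be a list of natural numbers and let $\mathcal{F}_b\subseteq\mathcal{L}([l_0,\ldots,l_m],n,P)$ be a subcollection that iso-represents $\mathcal{L}([l_0,\ldots,l_m],n,P)$. Then $$\mathcal{F}_b'=\bigcup_{A\in\mathcal{S}(n,m)}\{F\cup\{A\}: F\in\mathcal{F}_b,\ A\notin F,\ Q\,F\,A\}$$ is a subcollection of $\mathcal{L}([l_0,\ldots,l_{m-1},l_m+1],n,P)$ that iso-represents $\mathcal{L}([l_0,\ldots,l_{m-1},l_m+1],n,P)$.
   Context: All sets and families are finite; sets are sets of natural numbers and $[n]=\{0,1,\ldots,n-1\}$. A family $F$ is over $[n]$ if $\bigcup F\subseteq[n]$. For a list $L=[l_0,\ldots,l_m]$, a family $F$ is $L$-partitioned if every $A\in F$ has $|A|\le m$ and, for each $0\le i\le m$, exactly $l_i$ members of $F$ have exactly $i$ elements. $\mathcal{L}(L,n,P)$ denotes the collection of all $L$-partitioned families over $[n]$ satisfying $P$. $\mathcal{S}(n,m)$ is the collection of all $A\subseteq[n]$ with $|A|=m$. $Q$ incrementally checks $P$ if for every family $F$ and set $A$ with $|A|\ge|A'|$ for all $A'\in F$ and $A\notin F$: $P(F\cup\{A\})\iff(P(F)\text{ and }Q\,F\,A)$. $Q$ is preserved by injective functions if for every family $F$, set $A$ and function $f$ injective on $\bigcup F\cup A$, $Q\,F\,A$ implies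 $Q\,\{f[B]:B\in F\}\,f[A]$, where $f[B]$ is the image of $B$. Two families $F,F'$ are isomorphic if there is a bijection $f:\bigcup F\to\bigcup F'$ with $\{f[B]:B\in F\}=F'$. A collection $\mathcal{F}_b$ iso-represents a collection $\mathcal{F}$ if every $F\in\mathcal{F}$ is isomorphic to some $F_b\in\mathcal{F}_b$. -}

module Defs where

open import Data.Nat using (ℕ; _<_; _≤_; _≟_)
open import Data.Nat.Properties as ℕP using ()
open import Data.Fin using (Fin; toℕ)
open import Data.List using (List; []; _∷_; length; map; filter; concat; lookup; deduplicate)
open import Data.List.Properties using (≡-dec)
open import Data.List.Relation.Unary.All using (All)
open import Data.List.Relation.Unary.Linked using (Linked)
open import Data.List.Membership.Propositional using (_∈_; _∉_)
open import Data.List.Relation.Binary.Lex.Strict as Lex using (Lex-<)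
open import Data.Product using (Σ; ∃; ∃-syntax; _×_; _,_)
open import Function using (_∘_)
open import Function.Bundles using (_⇔_)
open import Relation.Binary.PropositionalEquality using (_≡_)
import Data.List.Sort

-- Finite sets of naturals are represented canonically as strictly
-- increasing lists; families (finite sets of such sets) canonically as
-- lists of sets that are strictly increasing in the lexicographic order.
-- Hence two (canonical) sets / families are equal iff they are ≡.

FSet : Set
FSet = List ℕ

Family : Set
Family = List FSet

IsSet : FSet → Set
IsSet A = Linked _<_ A

_<ₗ_ : FSet → FSet → Set
_<ₗ_ = Lex-< _≡_ _<_

IsFamily : Family → Set
IsFamily F = All IsSet F × Linked _<ₗ_ F

module SortN = Data.List.Sort ℕP.≤-decTotalOrder
module SortL = Data.List.Sort (Lex.≤-decTotalOrder ℕP.<-strictTotalOrder)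

canonSet : List ℕ → FSet
canonSet xs = SortN.sort (deduplicate _≟_ xs)

canonFamily : List FSet → Family
canonFamily xs = SortL.sort (deduplicate (≡-dec _≟_) xs)

_∪｛_｝ : Family → FSet → Family
F ∪｛ A ｝ = canonFamily (A ∷ F)

image : (ℕ → ℕ) → FSet → FSet
image f B = canonSet (map f B)

imageFamily : (ℕ → ℕ) → Family → Family
imageFamily f F = canonFamily (map (image f) F)

-- ⋃ F (as a list of elements; membership is what matters)
⋃ : Family → List ℕ
⋃ F = concat F

InjectiveOn : (ℕ → ℕ) → List ℕ → Set
InjectiveOn f xs = ∀ {x y} → x ∈ xs → y ∈ xs → f x ≡ f y → x ≡ y

Over : ℕ → Family → Set
Over n F = All (All (_< n)) F

-- F is L-partitioned, L = [l_0, ..., l_m] (so m + 1 = length L)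
Partitioned : List ℕ → Family → Set
Partitioned L F =
  All (λ A → length A < length L) F
  × (∀ (i : Fin (length L)) →
       length (filter (λ A → length A ≟ toℕ i) F) ≡ lookup L i)

Collection : Set₁
Collection = Family → Set

𝓛 : List ℕ → ℕ → (Family → Set) → Collection
𝓛 L n P F = IsFamily F × Over n F × Partitioned L F × P F

𝓢 : ℕ → ℕ → FSet → Set
𝓢 n m A = IsSet A × All (_< n) A × length A ≡ m

IncrementallyChecks : (Family → FSet → Set) → (Family → Set) → Set
IncrementallyChecks Q P =
  ∀ (F : Family) (A : FSet) → IsFamily F → IsSet A →
  All (λ A′ → length A′ ≤ length A) F → A ∉ F →
  (P (F ∪｛ A ｝) ⇔ (P F × Q F A))

PreservedByInjective : (Family → FSet → Set) → Set
PreservedByInjective Q =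
  ∀ (F : Family) (A : FSet) (f : ℕ → ℕ) → IsFamily F → IsSet A →
  InjectiveOn f (⋃ F Data.List.++ A) →
  Q F A → Q (imageFamily f F) (image f A)

-- isomorphic families: a map f that is a bijection ⋃F → ⋃F′
-- (injective on ⋃F, and mapping F onto F′, hence ⋃F onto ⋃F′)
Isomorphic : Family → Family → Set
Isomorphic F F′ = ∃[ f ] (InjectiveOn f (⋃ F) × imageFamily f F ≡ F′)

_⊆ᶜ_ : Collection → Collection → Set
𝓕 ⊆ᶜ 𝓖 = ∀ F → 𝓕 F → 𝓖 F

IsoRepresents : Collection → Collection → Set
IsoRepresents 𝓕b 𝓕 = ∀ F → 𝓕 F → ∃[ Fb ] (𝓕b Fb × Isomorphic F Fb)

extend : ℕ → ℕ → (Family → FSet → Set) → Collection → Collection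
extend n m Q 𝓕b G =
  ∃[ A ] ∃[ F ] (𝓢 n m A × 𝓕b F × A ∉ F × Q F A × G ≡ F ∪｛ A ｝)

module Submission where

-- Write L = [l₀,…,lₘ] and L⁺ = [l₀,…,lₘ₋₁,lₘ+1]. A family G ∈ 𝓛(L⁺, n, P) contains a set A of
-- the maximal size m, and G = F ∪ {A} for F = G ∖ {A}; incremental checking shows that
-- F ∪ {A} ∈ 𝓛(L⁺, n, P) exactly when F ∈ 𝓛(L, n, P) and Q F A. Hence some f injective on ⋃F maps
-- F onto an Fb ∈ 𝓕b. Since ⋃F and A lie in [n], counting shows that f extends to an injection g
-- on ⋃F ∪ A sending A ∖ ⋃F into [n] ∖ f[⋃F]. Then g maps G onto Fb ∪ {g[A]}, where g[A] ∉ Fb by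
-- injectivity and Q Fb g[A] because Q is preserved by injections; so Fb ∪ {g[A]} ∈ 𝓕b′.

open import Defs
open import Level using (0ℓ)
open import Data.Nat using (ℕ; suc; _≤_; _<_; _≟_; _+_; z≤n; s≤s)
import Data.Nat.Properties as ℕP
open import Data.Fin using (Fin; toℕ; cast; fromℕ<) renaming (zero to fzero; suc to fsuc)
open import Data.Fin.Properties using (toℕ-cast; toℕ-fromℕ<)
open import Data.List using (List; []; _∷_; length; _∷ʳ_; map; filter; lookup; deduplicate; upTo; _++_)
import Data.List.Properties as ListP
open import Data.List.Properties using (≡-dec)
open import Data.List.Relation.Unary.All as All using (All; []; _∷_)
import Data.List.Relation.Unary.All.Properties as AllP
open import Data.List.Relation.Unary.Any using (here; there)
open import Data.List.Relation.Unary.AllPairs as AllPairs using ([]; _∷_)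
open import Data.List.Relation.Unary.Linked using (Linked; []; [-]; _∷_)
import Data.List.Relation.Unary.Linked as Linked
import Data.List.Relation.Unary.Linked.Properties as LinkedP
open import Data.List.Relation.Unary.Unique.Propositional using (Unique)
import Data.List.Relation.Unary.Unique.Propositional.Properties as UniqueP
import Data.List.Relation.Unary.Unique.DecPropositional.Properties as UniqueDecP
open import Data.List.Membership.Propositional using (_∈_; _∉_)
import Data.List.Membership.Propositional.Properties as ∈P
open import Data.List.Relation.Binary.Subset.Propositional using (_⊆_)
import Data.List.Relation.Binary.Subset.Propositional.Properties as ⊆P
open import Data.List.Relation.Binary.Permutation.Propositional using (_↭_; ↭-sym; ↭⇒↭ₛ)
import Data.List.Relation.Binary.Permutation.Propositional.Properties as ↭P
import Data.List.Relation.Binary.Permutation.Setoid.Properties as ↭ₛP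
open import Data.List.Relation.Binary.Lex.Strict as Lex using (Lex-≤; base; halt; this; next)
open import Data.List.Relation.Binary.Pointwise using (≡⇒Pointwise-≡)
open import Data.Product using (∃-syntax; _×_; _,_; proj₁; proj₂)
open import Data.Sum using (inj₁; inj₂)
open import Data.Empty using (⊥; ⊥-elim)
open import Function using (_∘_; id)
open import Function.Bundles using (_⇔_; mk⇔; Equivalence)
open import Relation.Nullary using (¬_; Dec; yes; no; ¬?)
open import Relation.Binary.Bundles using (DecTotalOrder; StrictTotalOrder)
open import Relation.Binary.Definitions using (DecidableEquality)
open import Relation.Binary.PropositionalEquality
  using (_≡_; _≢_; refl; sym; trans; cong; subst; subst₂; setoid)
import Data.List.Sort

open Equivalence using (to; from)

module _ {A : Set} where

  ∈-∷-≢⇒∈ : ∀ {x y : A} {xs} → x ∈ y ∷ xs → x ≢ y → x ∈ xs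
  ∈-∷-≢⇒∈ (here x≡y) x≢y = ⊥-elim (x≢y x≡y)
  ∈-∷-≢⇒∈ (there x∈xs) _ = x∈xs

  Unique-⊆⇒length≤ : ∀ {xs ys : List A} → Unique xs → xs ⊆ ys → length xs ≤ length ys
  Unique-⊆⇒length≤ {[]} _ _ = z≤n
  Unique-⊆⇒length≤ {x ∷ xs} (x∉xs ∷ !xs) xs⊆ys with us , vs , refl ← ∈P.∈-∃++ (xs⊆ys (here refl)) =
    subst (suc (length xs) ≤_) (sym (ListP.length-++-sucʳ us x vs))
      (s≤s (Unique-⊆⇒length≤ !xs xs⊆us++vs))
    where
    xs⊆us++vs : xs ⊆ us ++ vs
    xs⊆us++vs {z} z∈xs with ∈P.∈-++⁻ us (xs⊆ys (there z∈xs))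
    ... | inj₁ z∈us = ∈P.∈-++⁺ˡ z∈us
    ... | inj₂ z∈x∷vs = ∈P.∈-++⁺ʳ us (∈-∷-≢⇒∈ z∈x∷vs (λ z≡x → All.lookup x∉xs z∈xs (sym z≡x)))

  length-filter-∁ : ∀ {p} {P : A → Set p} (P? : ∀ x → Dec (P x)) xs →
    length (filter P? xs) + length (filter (¬? ∘ P?) xs) ≡ length xs
  length-filter-∁ P? [] = refl
  length-filter-∁ P? (x ∷ xs) with P? x
  ... | yes _ = cong suc (length-filter-∁ P? xs)
  ... | no _ = trans (ℕP.+-suc _ _) (cong suc (length-filter-∁ P? xs))

  length-∷ʳ : ∀ (xs : List A) {x} → length (xs ∷ʳ x) ≡ suc (length xs)
  length-∷ʳ [] = refl
  length-∷ʳ (_ ∷ xs) = cong suc (length-∷ʳ xs)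

  <-length-∷ʳ : ∀ {k} (xs : List A) {x} → k < length (xs ∷ʳ x) ⇔ k ≤ length xs
  <-length-∷ʳ xs {x} rewrite length-∷ʳ xs {x} = mk⇔ ℕP.≤-pred s≤s

  Unique-dedup-id : ∀ (_≟ᴬ_ : DecidableEquality A) {xs} → Unique xs → deduplicate _≟ᴬ_ xs ≡ xs
  Unique-dedup-id _≟ᴬ_ {[]} _ = refl
  Unique-dedup-id _≟ᴬ_ {x ∷ xs} (x∉xs ∷ !xs) rewrite Unique-dedup-id _≟ᴬ_ !xs =
    cong (x ∷_) (ListP.filter-all (¬? ∘ (x ≟ᴬ_)) x∉xs)

InjectiveOn-⊆ : ∀ {f xs ys} → xs ⊆ ys → InjectiveOn f ys → InjectiveOn f xs
InjectiveOn-⊆ xs⊆ys inj x∈ y∈ = inj (xs⊆ys x∈) (xs⊆ys y∈)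

Unique-map⁺ : ∀ {f xs} → InjectiveOn f xs → Unique xs → Unique (map f xs)
Unique-map⁺ {xs = []} _ [] = []
Unique-map⁺ {f} {x ∷ xs} inj (x∉xs ∷ !xs) =
  AllP.map⁺ (All.tabulate (λ y∈xs fx≡fy → All.lookup x∉xs y∈xs (inj (here refl) (there y∈xs) fx≡fy)))
  ∷ Unique-map⁺ (InjectiveOn-⊆ there inj) !xs

-- Strictly sorted lists

module StrictlySorted {A : Set} (_≺_ : A → A → Set)
  (≺-trans : ∀ {x y z} → x ≺ y → y ≺ z → x ≺ z) (≺-irrefl : ∀ {x} → ¬ x ≺ x) where

  Linked⇒Unique : ∀ {xs} → Linked _≺_ xs → Unique xs
  Linked⇒Unique l =
    AllPairs.map (λ x≺y x≡y → ≺-irrefl (subst (_≺ _) x≡y x≺y)) (LinkedP.Linked⇒AllPairs ≺-trans l)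

  head-minimal : ∀ {x xs z} → Linked _≺_ (x ∷ xs) → z ∈ xs → x ≺ z
  head-minimal (x≺y ∷ l) = All.lookup (LinkedP.Linked⇒All ≺-trans x≺y l)

  ⊆-tail : ∀ {x xs ys} → Linked _≺_ (x ∷ xs) → x ∷ xs ⊆ x ∷ ys → xs ⊆ ys
  ⊆-tail l sub z∈xs with sub (there z∈xs)
  ... | here refl = ⊥-elim (≺-irrefl (head-minimal l z∈xs))
  ... | there z∈ys = z∈ys

  head-≡ : ∀ {x y xs ys} → Linked _≺_ (x ∷ xs) → Linked _≺_ (y ∷ ys) → x ∈ y ∷ ys → y ∈ x ∷ xs → x ≡ y
  head-≡ _ _ (here x≡y) _ = x≡y
  head-≡ _ _ _ (here y≡x) = sym y≡x
  head-≡ lx ly (there x∈ys) (there y∈xs) =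
    ⊥-elim (≺-irrefl (≺-trans (head-minimal ly x∈ys) (head-minimal lx y∈xs)))

  Linked-ext : ∀ {xs ys} → Linked _≺_ xs → Linked _≺_ ys → xs ⊆ ys → ys ⊆ xs → xs ≡ ys
  Linked-ext {[]} {[]} _ _ _ _ = refl
  Linked-ext {[]} {_ ∷ _} _ _ _ ys⊆xs with () ← ys⊆xs (here refl)
  Linked-ext {_ ∷ _} {[]} _ _ xs⊆ys _ with () ← xs⊆ys (here refl)
  Linked-ext {x ∷ xs} {y ∷ ys} lx ly xs⊆ys ys⊆xs
    with refl ← head-≡ lx ly (xs⊆ys (here refl)) (ys⊆xs (here refl)) =
    cong (x ∷_) (Linked-ext (Linked.tail lx) (Linked.tail ly) (⊆-tail lx xs⊆ys) (⊆-tail ly ys⊆xs))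

  Linked≤∧Unique⇒Linked≺ : ∀ {ℓ} {_≼_ : A → A → Set ℓ} → (∀ {x y} → x ≼ y → x ≢ y → x ≺ y) →
    ∀ {xs} → Linked _≼_ xs → Unique xs → Linked _≺_ xs
  Linked≤∧Unique⇒Linked≺ _ [] _ = []
  Linked≤∧Unique⇒Linked≺ _ [-] _ = [-]
  Linked≤∧Unique⇒Linked≺ ≼∧≢⇒≺ (x≼y ∷ l) ((x≢y ∷ _) ∷ !xs) =
    ≼∧≢⇒≺ x≼y x≢y ∷ Linked≤∧Unique⇒Linked≺ ≼∧≢⇒≺ l !xs

-- Canonical forms

module Canonical {ℓ₁ ℓ₂} (O : DecTotalOrder 0ℓ ℓ₁ ℓ₂)
  (_≟ᶜ_ : DecidableEquality (DecTotalOrder.Carrier O))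
  (_≺_ : DecTotalOrder.Carrier O → DecTotalOrder.Carrier O → Set)
  (≺-trans : ∀ {x y z} → x ≺ y → y ≺ z → x ≺ z) (≺-irrefl : ∀ {x} → ¬ x ≺ x)
  (≼∧≢⇒≺ : ∀ {x y} → DecTotalOrder._≤_ O x y → x ≢ y → x ≺ y) where

  open DecTotalOrder O using (Carrier)
  open StrictlySorted _≺_ ≺-trans ≺-irrefl public
  private module S = Data.List.Sort O

  canon : List Carrier → List Carrier
  canon xs = S.sort (deduplicate _≟ᶜ_ xs)

  ∈-canon⁺ : ∀ xs → xs ⊆ canon xs
  ∈-canon⁺ xs = ↭P.∈-resp-↭ (↭-sym (S.sort-↭ _)) ∘ ∈P.∈-deduplicate⁺ _≟ᶜ_

  ∈-canon⁻ : ∀ xs → canon xs ⊆ xs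
  ∈-canon⁻ xs = ∈P.∈-deduplicate⁻ _≟ᶜ_ xs ∘ ↭P.∈-resp-↭ (S.sort-↭ _)

  canon-Linked : ∀ xs → Linked _≺_ (canon xs)
  canon-Linked xs = Linked≤∧Unique⇒Linked≺ ≼∧≢⇒≺ (S.sort-↗ (deduplicate _≟ᶜ_ xs))
    (↭ₛP.Unique-resp-↭ (setoid Carrier) (↭⇒↭ₛ (↭-sym (S.sort-↭ _))) (UniqueDecP.deduplicate-! _≟ᶜ_ xs))

  canon-↭ : ∀ {xs} → Unique xs → canon xs ↭ xs
  canon-↭ {xs} !xs = subst (canon xs ↭_) (Unique-dedup-id _≟ᶜ_ !xs) (S.sort-↭ _)

  canon-≡ : ∀ {xs ys} → Linked _≺_ ys → xs ⊆ ys → ys ⊆ xs → canon xs ≡ ys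
  canon-≡ {xs} lys xs⊆ys ys⊆xs = Linked-ext (canon-Linked xs) lys (xs⊆ys ∘ ∈-canon⁻ xs) (∈-canon⁺ xs ∘ ys⊆xs)

module Lexℕ = StrictTotalOrder (Lex.<-strictTotalOrder ℕP.<-strictTotalOrder)

Lex-≤∧≢⇒< : ∀ {xs ys : FSet} → Lex-≤ _≡_ _<_ xs ys → xs ≢ ys → xs <ₗ ys
Lex-≤∧≢⇒< (base _) xs≢ys = ⊥-elim (xs≢ys refl)
Lex-≤∧≢⇒< halt _ = halt
Lex-≤∧≢⇒< (this x<y) _ = this x<y
Lex-≤∧≢⇒< {x ∷ _} (next refl xs≤ys) xs≢ys = next refl (Lex-≤∧≢⇒< xs≤ys (xs≢ys ∘ cong (x ∷_)))

module CanonSet = Canonical ℕP.≤-decTotalOrder _≟_ _<_ ℕP.<-trans (ℕP.<-irrefl refl) ℕP.≤∧≢⇒<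
module CanonFamily = Canonical (Lex.≤-decTotalOrder ℕP.<-strictTotalOrder) (≡-dec _≟_) _<ₗ_
  Lexℕ.trans (Lexℕ.irrefl (≡⇒Pointwise-≡ refl)) Lex-≤∧≢⇒<

-- Insertion, removal and images

∈-∪｛｝⁺ : ∀ {F A} → A ∷ F ⊆ F ∪｛ A ｝
∈-∪｛｝⁺ {F} {A} = CanonFamily.∈-canon⁺ (A ∷ F)

∈-∪｛｝⁻ : ∀ {F A} → F ∪｛ A ｝ ⊆ A ∷ F
∈-∪｛｝⁻ {F} {A} = CanonFamily.∈-canon⁻ (A ∷ F)

All-∪｛｝ : ∀ {p} {R : FSet → Set p} {F A} → All R (F ∪｛ A ｝) ⇔ All R (A ∷ F)
All-∪｛｝ = mk⇔ (λ all → All.tabulate (All.lookup all ∘ ∈-∪｛｝⁺))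
               (λ all → All.tabulate (All.lookup all ∘ ∈-∪｛｝⁻))

∪｛｝-IsFamily : ∀ {F A} → IsFamily F → IsSet A → IsFamily (F ∪｛ A ｝)
∪｛｝-IsFamily {F} {A} (setsF , _) setA = from All-∪｛｝ (setA ∷ setsF) , CanonFamily.canon-Linked (A ∷ F)

∪｛｝-↭ : ∀ {F A} → IsFamily F → A ∉ F → F ∪｛ A ｝ ↭ A ∷ F
∪｛｝-↭ {F} {A} (_ , lF) A∉F =
  CanonFamily.canon-↭ {A ∷ F}
    (All.tabulate (λ B∈F A≡B → A∉F (subst (_∈ _) (sym A≡B) B∈F)) ∷ CanonFamily.Linked⇒Unique lF)

⋃-∪｛｝ : ∀ {F A} → ⋃ (F ∪｛ A ｝) ⊆ ⋃ F ++ A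
⋃-∪｛｝ {F} {A} x∈ with B , x∈B , B∈ ← ∈P.∈-concat⁻′ (F ∪｛ A ｝) x∈ with ∈-∪｛｝⁻ {F} B∈
... | here refl = ∈P.∈-++⁺ʳ (⋃ F) x∈B
... | there B∈F = ∈P.∈-++⁺ˡ (∈P.∈-concat⁺′ x∈B B∈F)

remove : Family → FSet → Family
remove G A = filter (λ B → ¬? (≡-dec _≟_ B A)) G

∉-remove : ∀ {G A} → A ∉ remove G A
∉-remove {G} A∈ = proj₂ (∈P.∈-filter⁻ _ {xs = G} A∈) refl

remove-IsFamily : ∀ {G A} → IsFamily G → IsFamily (remove G A)
remove-IsFamily (setsG , lG) = AllP.filter⁺ _ setsG , LinkedP.filter⁺ _ Lexℕ.trans lG

remove-∪｛｝ : ∀ {G A} → IsFamily G → A ∈ G → remove G A ∪｛ A ｝ ≡ G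
remove-∪｛｝ {G} {A} (_ , lG) A∈G = CanonFamily.canon-≡ lG ⊆G G⊆
  where
  ⊆G : A ∷ remove G A ⊆ G
  ⊆G (here refl) = A∈G
  ⊆G (there B∈) = proj₁ (∈P.∈-filter⁻ _ {xs = G} B∈)
  G⊆ : G ⊆ A ∷ remove G A
  G⊆ {B} B∈G with ≡-dec _≟_ B A
  ... | yes refl = here refl
  ... | no B≢A = there (∈P.∈-filter⁺ _ B∈G B≢A)

∈-image⁺ : ∀ {f B x} → x ∈ B → f x ∈ image f B
∈-image⁺ {f} {B} = CanonSet.∈-canon⁺ (map f B) ∘ ∈P.∈-map⁺ f

∈-image⁻ : ∀ {f B y} → y ∈ image f B → ∃[ x ] (x ∈ B × y ≡ f x)
∈-image⁻ {f} {B} = ∈P.∈-map⁻ f ∘ CanonSet.∈-canon⁻ (map f B)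

∈-imageFamily⁺ : ∀ {f F B} → B ∈ F → image f B ∈ imageFamily f F
∈-imageFamily⁺ {f} {F} = CanonFamily.∈-canon⁺ (map (image f) F) ∘ ∈P.∈-map⁺ (image f)

∈-imageFamily⁻ : ∀ {f F C} → C ∈ imageFamily f F → ∃[ B ] (B ∈ F × C ≡ image f B)
∈-imageFamily⁻ {f} {F} = ∈P.∈-map⁻ (image f) ∘ CanonFamily.∈-canon⁻ (map (image f) F)

∈-⋃-imageFamily⁺ : ∀ {f F x} → x ∈ ⋃ F → f x ∈ ⋃ (imageFamily f F)
∈-⋃-imageFamily⁺ {F = F} x∈ with B , x∈B , B∈F ← ∈P.∈-concat⁻′ F x∈ =
  ∈P.∈-concat⁺′ (∈-image⁺ x∈B) (∈-imageFamily⁺ B∈F)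

length-image : ∀ {f B} → InjectiveOn f B → Unique B → length (image f B) ≡ length B
length-image {f} {B} inj !B =
  trans (↭P.↭-length (CanonSet.canon-↭ (Unique-map⁺ inj !B))) (ListP.length-map f B)

image-⊆⇒⊆ : ∀ {f A B} → InjectiveOn f (A ++ B) → image f A ⊆ image f B → A ⊆ B
image-⊆⇒⊆ {f} {A} {B} inj sub x∈A with y , y∈B , fx≡fy ← ∈-image⁻ (sub (∈-image⁺ {f} x∈A)) =
  subst (_∈ B) (sym (inj (∈P.∈-++⁺ˡ x∈A) (∈P.∈-++⁺ʳ A y∈B) fx≡fy)) y∈B

image-injective : ∀ {f A B} → IsSet A → IsSet B → InjectiveOn f (A ++ B) → image f A ≡ image f B → A ≡ B
image-injective {A = A} {B} setA setB inj fA≡fB = CanonSet.Linked-ext setA setB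
  (image-⊆⇒⊆ inj (⊆P.⊆-reflexive fA≡fB))
  (image-⊆⇒⊆ (InjectiveOn-⊆ (⊆P.⊆-reflexive-↭ (↭P.++-comm B A)) inj) (⊆P.⊆-reflexive (sym fA≡fB)))

image-∉ : ∀ {f F A} → IsFamily F → IsSet A → A ∉ F → InjectiveOn f (⋃ F ++ A) → image f A ∉ imageFamily f F
image-∉ {f} {F} {A} (setsF , _) setA A∉F inj fA∈ with B , B∈F , fA≡fB ← ∈-imageFamily⁻ fA∈ =
  A∉F (subst (_∈ F) (sym (image-injective setA (All.lookup setsF B∈F) injAB fA≡fB)) B∈F)
  where
  injAB : InjectiveOn f (A ++ B)
  injAB = InjectiveOn-⊆
    (⊆P.⊆-reflexive-↭ (↭P.++-comm A (⋃ F)) ∘ ⊆P.++⁺ʳ A (λ x∈B → ∈P.∈-concat⁺′ x∈B B∈F)) inj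

imageFamily-cong : ∀ {f g} F → All (λ x → f x ≡ g x) (⋃ F) → imageFamily f F ≡ imageFamily g F
imageFamily-cong F f≗g =
  cong canonFamily (ListP.map-cong-local (All.map (cong canonSet ∘ ListP.map-cong-local) (AllP.concat⁻ f≗g)))

imageFamily-∪｛｝ : ∀ {f F A} → imageFamily f (F ∪｛ A ｝) ≡ imageFamily f F ∪｛ image f A ｝
imageFamily-∪｛｝ {f} {F} {A} = CanonFamily.canon-≡ {map (image f) (F ∪｛ A ｝)}
  (CanonFamily.canon-Linked (image f A ∷ imageFamily f F)) ⊆new new⊆
  where
  ⊆new : map (image f) (F ∪｛ A ｝) ⊆ imageFamily f F ∪｛ image f A ｝
  ⊆new C∈ with B , B∈ , refl ← ∈P.∈-map⁻ _ C∈ with ∈-∪｛｝⁻ {F} B∈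
  ... | here refl = ∈-∪｛｝⁺ {imageFamily f F} (here refl)
  ... | there B∈F = ∈-∪｛｝⁺ {imageFamily f F} (there (∈-imageFamily⁺ B∈F))
  new⊆ : imageFamily f F ∪｛ image f A ｝ ⊆ map (image f) (F ∪｛ A ｝)
  new⊆ C∈ with ∈-∪｛｝⁻ {imageFamily f F} C∈
  ... | here refl = ∈P.∈-map⁺ (image f) (∈-∪｛｝⁺ {F} (here refl))
  ... | there C∈fF with B , B∈F , refl ← ∈-imageFamily⁻ {F = F} C∈fF =
    ∈P.∈-map⁺ (image f) (∈-∪｛｝⁺ {F} (there B∈F))

All-image⁺ : ∀ {p} {R : ℕ → Set p} {f B} → All (R ∘ f) B → All R (image f B)
All-image⁺ {R = R} {f} {B} R∘f = All.tabulate (λ y∈ → R-at (∈-image⁻ {f} {B} y∈))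
  where
  R-at : ∀ {y} → ∃[ x ] (x ∈ B × y ≡ f x) → R y
  R-at (x , x∈B , refl) = All.lookup R∘f x∈B

Over-imageFamily⇒All< : ∀ {n f} F → Over n (imageFamily f F) → All (λ x → f x < n) (⋃ F)
Over-imageFamily⇒All< F over = All.tabulate (All.lookup (AllP.concat⁺ over) ∘ ∈-⋃-imageFamily⁺ {F = F})

-- Counting sets by size

≡⇔≡-injective : ∀ (s : ℕ → ℕ) → (∀ {a b} → s a ≡ s b → a ≡ b) → ∀ {c c′ l l′} →
  c′ ≡ s c → l′ ≡ s l → (c ≡ l) ⇔ (c′ ≡ l′)
≡⇔≡-injective s s-injective c′≡ l′≡ =
  mk⇔ (λ c≡l → trans c′≡ (trans (cong s c≡l) (sym l′≡)))
      (λ c′≡l′ → s-injective (trans (sym c′≡) (trans c′≡l′ l′≡)))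

lookup-∷ʳ-last : ∀ (xs : List ℕ) {x} (i : Fin (length (xs ∷ʳ x))) → toℕ i ≡ length xs → lookup (xs ∷ʳ x) i ≡ x
lookup-∷ʳ-last [] fzero _ = refl
lookup-∷ʳ-last (_ ∷ xs) (fsuc i) i≡ = lookup-∷ʳ-last xs i (ℕP.suc-injective i≡)

lastIndex : ∀ (xs : List ℕ) {x} → Fin (length (xs ∷ʳ x))
lastIndex xs = fromℕ< (from (<-length-∷ʳ xs) ℕP.≤-refl)

toℕ-lastIndex : ∀ (xs : List ℕ) {x} → toℕ (lastIndex xs {x}) ≡ length xs
toℕ-lastIndex xs = toℕ-fromℕ< _

lookup-∷ʳ-init : ∀ (xs : List ℕ) {x y} (i : Fin (length (xs ∷ʳ x))) (j : Fin (length (xs ∷ʳ y))) →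
  toℕ i ≡ toℕ j → toℕ i ≢ length xs → lookup (xs ∷ʳ x) i ≡ lookup (xs ∷ʳ y) j
lookup-∷ʳ-init [] fzero _ _ i≢ = ⊥-elim (i≢ refl)
lookup-∷ʳ-init (_ ∷ xs) fzero fzero _ _ = refl
lookup-∷ʳ-init (_ ∷ xs) (fsuc i) (fsuc j) i≡j i≢ =
  lookup-∷ʳ-init xs i j (ℕP.suc-injective i≡j) (i≢ ∘ cong suc)

count : ℕ → Family → ℕ
count k F = length (filter (λ A → length A ≟ k) F)

Counts : List ℕ → Family → Set
Counts L F = ∀ (i : Fin (length L)) → count (toℕ i) F ≡ lookup L i

count-↭ : ∀ {k F G} → F ↭ G → count k F ≡ count k G
count-↭ {k} F↭G = ↭P.↭-length (↭P.filter-↭ (λ A → length A ≟ k) F↭G)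

count-∷-≡ : ∀ {k A} F → length A ≡ k → count k (A ∷ F) ≡ suc (count k F)
count-∷-≡ {k} {A} F |A|≡k = cong length (ListP.filter-accept (λ B → length B ≟ k) {A} {F} |A|≡k)

count-∷-≢ : ∀ {k A} F → length A ≢ k → count k (A ∷ F) ≡ count k F
count-∷-≢ {k} {A} F |A|≢k = cong length (ListP.filter-reject (λ B → length B ≟ k) {A} {F} |A|≢k)

count≡suc⇒∃ : ∀ {k c} F → count k F ≡ suc c → ∃[ A ] (A ∈ F × length A ≡ k)
count≡suc⇒∃ {k} F count≡ with filter (λ A → length A ≟ k) F in eq
... | A ∷ _ = A , ∈P.∈-filter⁻ (λ B → length B ≟ k) {xs = F} (subst (A ∈_) (sym eq) (here refl))

Counts-↭ : ∀ {L F G} → F ↭ G → Counts L F → Counts L G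
Counts-↭ {F = F} {G} F↭G counts i = trans (sym (count-↭ {toℕ i} {F} {G} F↭G)) (counts i)

count-lookup-∷ʳ : ∀ {A F} ls {x} → length A ≡ length ls →
  (i : Fin (length (ls ∷ʳ x))) (j : Fin (length (ls ∷ʳ suc x))) → toℕ i ≡ toℕ j →
  (count (toℕ i) F ≡ lookup (ls ∷ʳ x) i) ⇔ (count (toℕ j) (A ∷ F) ≡ lookup (ls ∷ʳ suc x) j)
count-lookup-∷ʳ {A} {F} ls |A| i j i≡j with toℕ i ≟ length ls
... | yes i≡ls = ≡⇔≡-injective suc ℕP.suc-injective
  (trans (count-∷-≡ {A = A} F (trans |A| (trans (sym i≡ls) i≡j))) (cong (λ k → suc (count k F)) (sym i≡j)))
  (trans (lookup-∷ʳ-last ls j (trans (sym i≡j) i≡ls)) (cong suc (sym (lookup-∷ʳ-last ls i i≡ls))))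
... | no i≢ls = ≡⇔≡-injective id id
  (trans (count-∷-≢ {A = A} F (λ |A|≡j → i≢ls (trans i≡j (trans (sym |A|≡j) |A|))))
         (cong (λ k → count k F) (sym i≡j)))
  (sym (lookup-∷ʳ-init ls i j i≡j i≢ls))

Counts-∷ʳ : ∀ {A F} ls {x} → length A ≡ length ls → Counts (ls ∷ʳ x) F ⇔ Counts (ls ∷ʳ suc x) (A ∷ F)
Counts-∷ʳ {A} {F} ls {x} |A| = mk⇔
  (λ counts j → to (count-lookup-∷ʳ {A} {F} ls |A| (cast (sym eq) j) j (toℕ-cast (sym eq) j))
                    (counts (cast (sym eq) j)))
  (λ counts i → from (count-lookup-∷ʳ {A} {F} ls |A| i (cast eq i) (sym (toℕ-cast eq i)))
                      (counts (cast eq i)))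
  where
  eq : length (ls ∷ʳ x) ≡ length (ls ∷ʳ suc x)
  eq = trans (length-∷ʳ ls) (sym (length-∷ʳ ls))

-- Extending an injection into [n]

pairing : List ℕ → List ℕ → ℕ → ℕ
pairing (a ∷ as) (b ∷ bs) x with x ≟ a
... | yes _ = b
... | no _ = pairing as bs x
pairing _ _ _ = 0

pairing-∈ : ∀ {as bs x} → length as ≤ length bs → x ∈ as → pairing as bs x ∈ bs
pairing-∈ {a ∷ as} {b ∷ bs} {x} (s≤s as≤bs) x∈ with x ≟ a
... | yes _ = here refl
... | no x≢a = there (pairing-∈ as≤bs (∈-∷-≢⇒∈ x∈ x≢a))

pairing-injective : ∀ {as bs x y} → Unique bs → length as ≤ length bs → x ∈ as → y ∈ as →
  pairing as bs x ≡ pairing as bs y → x ≡ y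
pairing-injective {a ∷ as} {b ∷ bs} {x} {y} (b∉bs ∷ !bs) (s≤s as≤bs) x∈ y∈ eq with x ≟ a | y ≟ a
... | yes x≡a | yes y≡a = trans x≡a (sym y≡a)
... | yes _ | no y≢a = ⊥-elim (All.lookup b∉bs (pairing-∈ as≤bs (∈-∷-≢⇒∈ y∈ y≢a)) eq)
... | no x≢a | yes _ = ⊥-elim (All.lookup b∉bs (pairing-∈ as≤bs (∈-∷-≢⇒∈ x∈ x≢a)) (sym eq))
... | no x≢a | no y≢a = pairing-injective !bs as≤bs (∈-∷-≢⇒∈ x∈ x≢a) (∈-∷-≢⇒∈ y∈ y≢a) eq

module InjectionExtension {n : ℕ} (U A : List ℕ) {f : ℕ → ℕ} (f-injective : InjectiveOn f U)
  (f<n : All (λ x → f x < n) U) (U<n : All (_< n) U) (A<n : All (_< n) A) where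

  open import Data.List.Membership.DecPropositional _≟_ using (_∈?_)

  Old : List ℕ
  Old = deduplicate _≟_ U

  New : List ℕ
  New = filter (λ x → ¬? (x ∈? U)) (deduplicate _≟_ A)

  Taken : List ℕ
  Taken = filter (_∈? map f Old) (upTo n)

  Free : List ℕ
  Free = filter (λ y → ¬? (y ∈? map f Old)) (upTo n)

  !New : Unique New
  !New = UniqueP.filter⁺ _ (UniqueDecP.deduplicate-! _≟_ A)

  !Free : Unique Free
  !Free = UniqueP.filter⁺ _ (UniqueP.upTo⁺ n)

  Old+New≤n : length Old + length New ≤ n
  Old+New≤n = subst₂ _≤_ (ListP.length-++ Old) (ListP.length-upTo n)
    (Unique-⊆⇒length≤ (UniqueP.++⁺ (UniqueDecP.deduplicate-! _≟_ U) !New disjoint) Old++New⊆[n])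
    where
    disjoint : ∀ {x} → x ∈ Old × x ∈ New → ⊥
    disjoint (x∈Old , x∈New) =
      proj₂ (∈P.∈-filter⁻ _ {xs = deduplicate _≟_ A} x∈New) (∈P.∈-deduplicate⁻ _≟_ U x∈Old)
    Old++New⊆[n] : Old ++ New ⊆ upTo n
    Old++New⊆[n] x∈ with ∈P.∈-++⁻ Old x∈
    ... | inj₁ x∈Old = ∈P.∈-upTo⁺ (All.lookup U<n (∈P.∈-deduplicate⁻ _≟_ U x∈Old))
    ... | inj₂ x∈New = ∈P.∈-upTo⁺ (All.lookup A<n (∈P.∈-deduplicate⁻ _≟_ A (proj₁ (∈P.∈-filter⁻ _ x∈New))))

  Taken≤Old : length Taken ≤ length Old
  Taken≤Old = subst (length Taken ≤_) (ListP.length-map f Old)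
    (Unique-⊆⇒length≤ (UniqueP.filter⁺ _ (UniqueP.upTo⁺ n)) (proj₂ ∘ ∈P.∈-filter⁻ _ {xs = upTo n}))

  New≤Free : length New ≤ length Free
  New≤Free = ℕP.+-cancelˡ-≤ (length Old) _ _ (begin
    length Old + length New     ≤⟨ Old+New≤n ⟩
    n                           ≡⟨ sym Taken+Free≡n ⟩
    length Taken + length Free  ≤⟨ ℕP.+-monoˡ-≤ (length Free) Taken≤Old ⟩
    length Old + length Free    ∎)
    where
    open ℕP.≤-Reasoning
    Taken+Free≡n : length Taken + length Free ≡ n
    Taken+Free≡n = trans (length-filter-∁ (_∈? map f Old) (upTo n)) (ListP.length-upTo n)

  g : ℕ → ℕ
  g x with x ∈? U
  ... | yes _ = f x
  ... | no _ = pairing New Free x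

  g-old : ∀ {x} → x ∈ U → g x ≡ f x
  g-old {x} x∈U with x ∈? U
  ... | yes _ = refl
  ... | no x∉U = ⊥-elim (x∉U x∈U)

  g-new : ∀ {x} → x ∉ U → g x ≡ pairing New Free x
  g-new {x} x∉U with x ∈? U
  ... | yes x∈U = ⊥-elim (x∉U x∈U)
  ... | no _ = refl

  ∈-New : ∀ {x} → x ∈ U ++ A → x ∉ U → x ∈ New
  ∈-New {x} x∈ x∉U with ∈P.∈-++⁻ U x∈
  ... | inj₁ x∈U = ⊥-elim (x∉U x∈U)
  ... | inj₂ x∈A = ∈P.∈-filter⁺ _ (∈P.∈-deduplicate⁺ _≟_ x∈A) x∉U

  g-new-∈Free : ∀ {x} → x ∈ U ++ A → x ∉ U → g x ∈ Free
  g-new-∈Free x∈ x∉U = subst (_∈ Free) (sym (g-new x∉U)) (pairing-∈ New≤Free (∈-New x∈ x∉U))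

  g-old≢g-new : ∀ {x y} → x ∈ U → y ∈ U ++ A → y ∉ U → g x ≢ g y
  g-old≢g-new {x} x∈U y∈ y∉U gx≡gy = proj₂ (∈P.∈-filter⁻ _ {xs = upTo n} (g-new-∈Free y∈ y∉U))
    (subst (_∈ map f Old) (trans (sym (g-old x∈U)) gx≡gy) (∈P.∈-map⁺ f (∈P.∈-deduplicate⁺ _≟_ x∈U)))

  g-injective : InjectiveOn g (U ++ A)
  g-injective {x} {y} x∈ y∈ gx≡gy = by-cases (x ∈? U) (y ∈? U)
    where
    by-cases : Dec (x ∈ U) → Dec (y ∈ U) → x ≡ y
    by-cases (yes x∈U) (yes y∈U) = f-injective x∈U y∈U (trans (sym (g-old x∈U)) (trans gx≡gy (g-old y∈U)))
    by-cases (yes x∈U) (no y∉U) = ⊥-elim (g-old≢g-new x∈U y∈ y∉U gx≡gy)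
    by-cases (no x∉U) (yes y∈U) = ⊥-elim (g-old≢g-new y∈U x∈ x∉U (sym gx≡gy))
    by-cases (no x∉U) (no y∉U) = pairing-injective !Free New≤Free (∈-New x∈ x∉U) (∈-New y∈ y∉U)
      (trans (sym (g-new x∉U)) (trans gx≡gy (g-new y∉U)))

  g<n : All (λ x → g x < n) A
  g<n = All.tabulate (λ {x} x∈A → by-cases x∈A (x ∈? U))
    where
    by-cases : ∀ {x} → x ∈ A → Dec (x ∈ U) → g x < n
    by-cases x∈A (yes x∈U) = subst (_< n) (sym (g-old x∈U)) (All.lookup f<n x∈U)
    by-cases x∈A (no x∉U) =
      ∈P.∈-upTo⁻ (proj₁ (∈P.∈-filter⁻ _ {xs = upTo n} (g-new-∈Free (∈P.∈-++⁺ʳ U x∈A) x∉U)))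

injection-extension : ∀ {n} (U A : List ℕ) {f : ℕ → ℕ} → InjectiveOn f U →
  All (λ x → f x < n) U → All (_< n) U → All (_< n) A →
  ∃[ g ] (All (λ x → g x ≡ f x) U × InjectiveOn g (U ++ A) × All (λ x → g x < n) A)
injection-extension U A f-injective f<n U<n A<n =
  g , All.tabulate g-old , g-injective , g<n
  where open InjectionExtension U A f-injective f<n U<n A<n

-- Families with one more set of the maximal size

∪｛｝∈𝓛⇔ : ∀ {P Q n ls lm F A} → IncrementallyChecks Q P → IsFamily F → 𝓢 n (length ls) A → A ∉ F →
  (𝓛 (ls ∷ʳ lm) n P F × Q F A) ⇔ 𝓛 (ls ∷ʳ suc lm) n P (F ∪｛ A ｝)
∪｛｝∈𝓛⇔ {P} {Q} {n} {ls} {lm} {F} {A} ic famF (setA , A<n , |A|) A∉F = mk⇔ insert delete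
  where
  at-most-|A| : ∀ {x k} → k < length (ls ∷ʳ x) → k ≤ length A
  at-most-|A| = subst (_ ≤_) (sym |A|) ∘ to (<-length-∷ʳ ls)

  resize : ∀ {x y k} → k < length (ls ∷ʳ x) → k < length (ls ∷ʳ y)
  resize = from (<-length-∷ʳ ls) ∘ to (<-length-∷ʳ ls)

  F∪A↭A∷F : F ∪｛ A ｝ ↭ A ∷ F
  F∪A↭A∷F = ∪｛｝-↭ famF A∉F

  P⇔ : All (λ B → length B < length (ls ∷ʳ lm)) F → P (F ∪｛ A ｝) ⇔ (P F × Q F A)
  P⇔ bound = ic F A famF setA (All.map at-most-|A| bound) A∉F

  insert : 𝓛 (ls ∷ʳ lm) n P F × Q F A → 𝓛 (ls ∷ʳ suc lm) n P (F ∪｛ A ｝)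
  insert ((_ , overF , (boundF , countsF) , pF) , qFA) =
    ∪｛｝-IsFamily famF setA ,
    from (All-∪｛｝ {F = F}) (A<n ∷ overF) ,
    ( from (All-∪｛｝ {F = F}) (from (<-length-∷ʳ ls) (ℕP.≤-reflexive |A|) ∷ All.map resize boundF)
    , Counts-↭ {ls ∷ʳ suc lm} (↭-sym F∪A↭A∷F) (to (Counts-∷ʳ {A} {F} ls |A|) countsF)) ,
    from (P⇔ boundF) (pF , qFA)

  delete : 𝓛 (ls ∷ʳ suc lm) n P (F ∪｛ A ｝) → 𝓛 (ls ∷ʳ lm) n P F × Q F A
  delete (_ , over , (bound , counts) , pG) =
    ( famF
    , All.tail (to (All-∪｛｝ {F = F}) over)
    , (boundF , from (Counts-∷ʳ {A} {F} ls |A|) (Counts-↭ {ls ∷ʳ suc lm} F∪A↭A∷F counts))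
    , proj₁ pF×qFA) ,
    proj₂ pF×qFA
    where
    boundF : All (λ B → length B < length (ls ∷ʳ lm)) F
    boundF = All.map resize (All.tail (to (All-∪｛｝ {F = F}) bound))
    pF×qFA : P F × Q F A
    pF×qFA = to (P⇔ boundF) pG

∃-maximal-∪｛｝ : ∀ {P n ls lm G} → 𝓛 (ls ∷ʳ suc lm) n P G →
  ∃[ A ] ∃[ F ] (𝓢 n (length ls) A × IsFamily F × A ∉ F × G ≡ F ∪｛ A ｝)
∃-maximal-∪｛｝ {ls = ls} {lm} {G} (famG , overG , (_ , countsG) , _)
  with A , A∈G , |A|≡ ←
    count≡suc⇒∃ G (trans (countsG (lastIndex ls)) (lookup-∷ʳ-last ls _ (toℕ-lastIndex ls))) =
  A , remove G A ,
  (All.lookup (proj₁ famG) A∈G , All.lookup overG A∈G , trans |A|≡ (toℕ-lastIndex ls)) ,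
  remove-IsFamily famG , ∉-remove {G} , sym (remove-∪｛｝ famG A∈G)

image-∪｛｝-isomorphic : ∀ {Q n m F Fb A g} → PreservedByInjective Q → IsFamily F → 𝓢 n m A → A ∉ F → Q F A →
  InjectiveOn g (⋃ F ++ A) → All (λ x → g x < n) A → imageFamily g F ≡ Fb →
  𝓢 n m (image g A) × image g A ∉ Fb × Q Fb (image g A) × Isomorphic (F ∪｛ A ｝) (Fb ∪｛ image g A ｝)
image-∪｛｝-isomorphic {F = F} {A = A} {g} pi famF (setA , _ , |A|) A∉F qFA g-injective g<n refl =
  (CanonSet.canon-Linked (map g A) , All-image⁺ g<n ,
    trans (length-image (InjectiveOn-⊆ (⊆P.xs⊆ys++xs A (⋃ F)) g-injective) (CanonSet.Linked⇒Unique setA))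
          |A|) ,
  image-∉ famF setA A∉F g-injective ,
  pi F A g famF setA g-injective qFA ,
  (g , InjectiveOn-⊆ (⋃-∪｛｝ {F}) g-injective , imageFamily-∪｛｝ {g} {F})

∪｛｝-isomorphic : ∀ {Q n m F Fb A f} → PreservedByInjective Q → IsFamily F → Over n F → Over n Fb →
  𝓢 n m A → A ∉ F → Q F A → InjectiveOn f (⋃ F) → imageFamily f F ≡ Fb →
  ∃[ A′ ] (𝓢 n m A′ × A′ ∉ Fb × Q Fb A′ × Isomorphic (F ∪｛ A ｝) (Fb ∪｛ A′ ｝))
∪｛｝-isomorphic {F = F} {A = A} pi famF overF overFb A∈𝓢@(_ , A<n , _) A∉F qFA f-injective refl
  with g , g≗f , g-injective , g<n ←
    injection-extension (⋃ F) A f-injective (Over-imageFamily⇒All< F overFb) (AllP.concat⁺ overF) A<n =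
  image g A ,
  image-∪｛｝-isomorphic pi famF A∈𝓢 A∉F qFA g-injective g<n (imageFamily-cong F g≗f)

theorem4 : (n m : ℕ) → m ≤ n →
    (P : Family → Set) (Q : Family → FSet → Set) →
    IncrementallyChecks Q P → PreservedByInjective Q →
    (ls : List ℕ) (lm : ℕ) → length ls ≡ m →
    (𝓕b : Collection) →
    𝓕b ⊆ᶜ 𝓛 (ls ∷ʳ lm) n P →
    IsoRepresents 𝓕b (𝓛 (ls ∷ʳ lm) n P) →
    (extend n m Q 𝓕b ⊆ᶜ 𝓛 (ls ∷ʳ suc lm) n P)
    × IsoRepresents (extend n m Q 𝓕b) (𝓛 (ls ∷ʳ suc lm) n P)
theorem4 n _ _ P Q ic pi ls lm refl 𝓕b 𝓕b⊆𝓛 𝓕b-represents = extension⊆𝓛 , extension-represents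
  where
  extension⊆𝓛 : extend n (length ls) Q 𝓕b ⊆ᶜ 𝓛 (ls ∷ʳ suc lm) n P
  extension⊆𝓛 _ (A , F , A∈𝓢 , F∈𝓕b , A∉F , qFA , refl) =
    to (∪｛｝∈𝓛⇔ {ls = ls} {lm} ic (proj₁ (𝓕b⊆𝓛 F F∈𝓕b)) A∈𝓢 A∉F) (𝓕b⊆𝓛 F F∈𝓕b , qFA)

  extension-represents : IsoRepresents (extend n (length ls) Q 𝓕b) (𝓛 (ls ∷ʳ suc lm) n P)
  extension-represents G G∈𝓛
    with A , F , A∈𝓢 , famF , A∉F , refl ← ∃-maximal-∪｛｝ {P} {ls = ls} {lm} G∈𝓛
    with F∈𝓛@(_ , overF , _) , qFA ← from (∪｛｝∈𝓛⇔ {ls = ls} {lm} ic famF A∈𝓢 A∉F) G∈𝓛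
    with Fb , Fb∈𝓕b , f , f-injective , fF≡Fb ← 𝓕b-represents F F∈𝓛
    with A′ , A′∈𝓢 , A′∉Fb , qFbA′ , F∪A≅Fb∪A′ ←
      ∪｛｝-isomorphic pi famF overF (proj₁ (proj₂ (𝓕b⊆𝓛 Fb Fb∈𝓕b))) A∈𝓢 A∉F qFA f-injective fF≡Fb =
    Fb ∪｛ A′ ｝ , (A′ , Fb , A′∈𝓢 , Fb∈𝓕b , A′∉Fb , qFbA′ , refl) , F∪A≅Fb∪A′
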